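{- The Prover strategy $\mathfrak P$ described in the context is validity-preserving: every play of the proof search game in which Prover follows $\mathfrak P$, starting from an $\mathcal L$-valid sequent, visits only $\mathcal L$-valid sequents.
   Context: Fix a finite alphabet $\mathcal{A}$. RLL expressions: $e,f::= X\mid ae\mid 0\mid e+f\mid \mu X e\mid \top\mid e\cap f\mid \nu X e$ ($X$ a variable, $a\in\mathcal{A}$), $\mu,\nu$ binding $X$; closed = no free variables; $e(g)$ denotes substitution. Semantics (closed expressions, subsets $A\subseteq\mathcal{A}^\omega$ allowed as constants with $\mathcal L(A)=A$): $\mathcal L(0)=\emptyset$, $\mathcal L(\top)=\mathcal{A}^\omega$, $\mathcal L(ae)=\{aw:w\in\mathcal L(e)\}$, $\mathcal L(e+f)=\mathcal L(e)\cup\mathcal L(f)$, $\mathcal L(e\cap f)=\mathcal L(e)\cap\mathcal L(f)$, $\mathcal L(\mu Xe(X))=\bigcap\{A:\mathcal L(e(A))\subseteq A\}$, $\mathcal L(\nu Xe(X))=\bigcup\{A:A\subseteq\mathcal L(e(A))\}$. A sequent $\Gamma\rightarrow\Delta$ ($\Gamma,\Delta$ finite sets of closed expressions) is $\mathcal L$-valid if $\bigcap_{e\in\Gamma}\mathcal L(e)\subseteq\bigcup_{f\in\Delta}\mathcal L(f)$ (empty intersection $=\mathcal{A}^\omega$, empty union $=\emptyset$). Notation: $\Gamma,e=\Gamma\cup\{e\}$, $a\Gamma=\{ae:e\in\Gamma\}$. Rules of $\mathsf L\widehat{\mathsf{RLL}}_{\mathcal L}$: letter rules ($\mathsf p$-l)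 axiom $ae,bf\rightarrow$ for $a\neq b$; ($\mathsf h_a$) from $\Gamma\rightarrow\Delta$ infer $a\Gamma\rightarrow a\Delta$ if $\Gamma\neq\emptyset$; ($\mathsf p$-r) from $\rightarrow\Gamma_a$ for each $a\in\mathcal{A}$ infer $\rightarrow\bigcup_a a\Gamma_a$; weakening on either side; left logical rules ($0$-l) axiom $\Gamma,0\rightarrow\Delta$; ($\top$-l) from $\Gamma\rightarrow\Delta$ infer $\Gamma,\top\rightarrow\Delta$; ($+$-l) from $\Gamma,e\rightarrow\Delta$ and $\Gamma,f\rightarrow\Delta$ infer $\Gamma,e+f\rightarrow\Delta$; ($\cap$-l) from $\Gamma,e,f\rightarrow\Delta$ infer $\Gamma,e\cap f\rightarrow\Delta$; ($\sigma$-l) from $\Gamma,e(\sigma Xe(X))\rightarrow\Delta$ infer $\Gamma,\sigma Xe(X)\rightarrow\Delta$ ($\sigma\in\{\mu,\nu\}$); right logical rules ($0$-r) from $\Gamma\rightarrow\Delta$ infer $\Gamma\rightarrow\Delta,0$; ($\top$-r) axiom $\Gamma\rightarrow\Delta,\top$; ($+$-r) from $\Gamma\rightarrow\Delta,e,f$ infer $\Gamma\rightarrow\Delta,e+f$; ($\cap$-r) from $\Gamma\rightarrow\Delta,e$ and $\Gamma\rightarrow\Delta,f$ infer $\Gamma\rightarrow\Delta,e\cap f$; ($\sigma$-r) from $\Gamma\rightarrow\Delta,e(\sigma Xe(X))$ infer $\Gamma\rightarrow\Delta,\sigma Xe(X)$. Proof search game: from the current sequent Prover chooses an inference step with that sequent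 as conclusion; Denier then chooses one of its premisses as the new current sequent. Strategy $\mathfrak P$ (bottom-up): whenever some left or right logical rule applies to the current sequent, $\mathfrak P$ applies one. Otherwise every formula in the sequent has form $ae$, and: if the LHS contains $ae$ and $bf$ with $a\neq b$, $\mathfrak P$ weakens away all other formulas on both sides and applies ($\mathsf p$-l); if the sequent is $a\Gamma\rightarrow\bigcup_{b\in\mathcal{A}}b\Delta_b$ with $\Gamma\neq\emptyset$, $\mathfrak P$ weakens away all $b\Delta_b$ with $b\neq a$ and applies $\mathsf h_a$, giving premiss $\Gamma\rightarrow\Delta_a$; if the sequent is $\rightarrow\bigcup_{a\in\mathcal{A}}a\Delta_a$, $\mathfrak P$ applies ($\mathsf p$-r). -}

module Defs where

open import Level using (0ℓ) renaming (suc to lsuc)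
open import Data.Nat using (ℕ; zero; suc)
open import Data.Fin using (Fin; zero; suc; _≟_)
open import Data.Bool using (if_then_else_)
open import Data.Maybe using (Maybe; just; nothing)
open import Data.Product using (Σ; ∃; _×_; _,_; proj₁; proj₂)
open import Data.Sum using (_⊎_)
open import Data.Empty using (⊥)
open import Data.Unit using (⊤)
open import Data.List using (List; []; _∷_; map; mapMaybe)
open import Data.List.Membership.Propositional using (_∈_)
open import Data.List.Relation.Unary.All using (All)
open import Data.List.Relation.Unary.Any using (Any)
open import Relation.Nullary using (¬_; does)
open import Relation.Nullary.Decidable using (True)
open import Relation.Binary.PropositionalEquality using (_≡_; _≢_)
open import Axiom.ExcludedMiddle using (ExcludedMiddle)

-- Alphabet: 𝒜 = Fin k (an arbitrary finite alphabet).
-- RLL expressions over 𝒜 with at most n free variables (de Bruijn).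

data Expr (k n : ℕ) : Set where
  var   : Fin n → Expr k n
  _∙_   : Fin k → Expr k n → Expr k n
  0ᵉ    : Expr k n
  _+ᵉ_  : Expr k n → Expr k n → Expr k n
  μ     : Expr k (suc n) → Expr k n
  ⊤ᵉ    : Expr k n
  _∩ᵉ_  : Expr k n → Expr k n → Expr k n
  ν     : Expr k (suc n) → Expr k n

infixr 6 _∙_

Closed : ℕ → Set
Closed k = Expr k 0

ext : ∀ {m n} → (Fin m → Fin n) → Fin (suc m) → Fin (suc n)
ext ρ zero    = zero
ext ρ (suc i) = suc (ρ i)

ren : ∀ {k m n} → (Fin m → Fin n) → Expr k m → Expr k n
ren ρ (var i)    = var (ρ i)
ren ρ (a ∙ e)    = a ∙ ren ρ e
ren ρ 0ᵉ         = 0ᵉ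
ren ρ (e +ᵉ f)   = ren ρ e +ᵉ ren ρ f
ren ρ (μ e)      = μ (ren (ext ρ) e)
ren ρ ⊤ᵉ         = ⊤ᵉ
ren ρ (e ∩ᵉ f)   = ren ρ e ∩ᵉ ren ρ f
ren ρ (ν e)      = ν (ren (ext ρ) e)

exts : ∀ {k m n} → (Fin m → Expr k n) → Fin (suc m) → Expr k (suc n)
exts σ zero    = var zero
exts σ (suc i) = ren suc (σ i)

sub : ∀ {k m n} → (Fin m → Expr k n) → Expr k m → Expr k n
sub σ (var i)    = σ i
sub σ (a ∙ e)    = a ∙ sub σ e
sub σ 0ᵉ         = 0ᵉ
sub σ (e +ᵉ f)   = sub σ e +ᵉ sub σ f
sub σ (μ e)      = μ (sub (exts σ) e)
sub σ ⊤ᵉ         = ⊤ᵉ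
sub σ (e ∩ᵉ f)   = sub σ e ∩ᵉ sub σ f
sub σ (ν e)      = ν (sub (exts σ) e)

_[_] : ∀ {k n} → Expr k (suc n) → Expr k n → Expr k n
e [ g ] = sub σ e
  where
  σ : _
  σ zero    = g
  σ (suc i) = var i

Word : ℕ → Set
Word k = ℕ → Fin k

Lang : ℕ → Set₁
Lang k = Word k → Set

tail : ∀ {k} → Word k → Word k
tail w n = w (suc n)

_∷ᵉ_ : ∀ {k n} → Lang k → (Fin n → Lang k) → Fin (suc n) → Lang k
(A ∷ᵉ ρ) zero    = A
(A ∷ᵉ ρ) (suc i) = ρ i

_⊆_ : ∀ {k} → Lang k → Lang k → Set
A ⊆ B = ∀ w → A w → B w

-- The set-theoretic semantics is classical and impredicative
-- (μ/ν quantify over all subsets of 𝒜^ω).  We work relative to the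
-- law of excluded middle, which lets us resize the (large) proposition
-- defining membership in a fixed point back to a small one.
Resize : ExcludedMiddle (lsuc 0ℓ) → Set₁ → Set
Resize em P = True (em {P})

-- ⟦ e ⟧ ρ : semantics of e when its free variables are interpreted by the
-- subsets ρ (this is 𝓛 of e with the subsets substituted as constants).
⟦_⟧ : ∀ {k n} → Expr k n → ExcludedMiddle (lsuc 0ℓ) → (Fin n → Lang k) → Lang k
⟦ var i ⟧  em ρ w = ρ i w
⟦ a ∙ e ⟧  em ρ w = (w 0 ≡ a) × ⟦ e ⟧ em ρ (tail w)
⟦ 0ᵉ ⟧     em ρ w = ⊥
⟦ e +ᵉ f ⟧ em ρ w = ⟦ e ⟧ em ρ w ⊎ ⟦ f ⟧ em ρ w
⟦ μ e ⟧    em ρ w =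
  Resize em ((A : Lang k) → ⟦ e ⟧ em (A ∷ᵉ ρ) ⊆ A → A w)
  where k = _
⟦ ⊤ᵉ ⟧     em ρ w = ⊤
⟦ e ∩ᵉ f ⟧ em ρ w = ⟦ e ⟧ em ρ w × ⟦ f ⟧ em ρ w
⟦ ν e ⟧    em ρ w =
  Resize em (Σ (Lang k) λ A → (A ⊆ ⟦ e ⟧ em (A ∷ᵉ ρ)) × A w)
  where k = _

𝓛 : ∀ {k} → ExcludedMiddle (lsuc 0ℓ) → Closed k → Lang k
𝓛 em e = ⟦ e ⟧ em (λ ())

-- Sequents Γ → Δ: finite sets of closed expressions, represented by
-- lists and compared up to having the same elements.

Cedent : ℕ → Set
Cedent k = List (Closed k)

Sequent : ℕ → Set
Sequent k = Cedent k × Cedent k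

lhs rhs : ∀ {k} → Sequent k → Cedent k
lhs = proj₁
rhs = proj₂

_≋_ : ∀ {k} → Cedent k → Cedent k → Set
Γ ≋ Γ' = (∀ {e} → e ∈ Γ → e ∈ Γ') × (∀ {e} → e ∈ Γ' → e ∈ Γ)

_≈_ : ∀ {k} → Sequent k → Sequent k → Set
S ≈ S' = (lhs S ≋ lhs S') × (rhs S ≋ rhs S')

Valid : ∀ {k} → ExcludedMiddle (lsuc 0ℓ) → Sequent k → Set
Valid em (Γ , Δ) = ∀ w → All (λ e → 𝓛 em e w) Γ → Any (λ f → 𝓛 em f w) Δ

-- Left and right logical rules: LogicalRule premisses conclusion.
-- (Γ , e stands for Γ ∪ {e}; rule instances are matched against the
-- current sequent up to set equality ≈.)

data LogicalRule {k} : List (Sequent k) → Sequent k → Set where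
  0-l  : ∀ {Γ Δ} → LogicalRule [] (0ᵉ ∷ Γ , Δ)
  ⊤-l  : ∀ {Γ Δ} → LogicalRule ((Γ , Δ) ∷ []) (⊤ᵉ ∷ Γ , Δ)
  +-l  : ∀ {Γ Δ e f} → LogicalRule ((e ∷ Γ , Δ) ∷ (f ∷ Γ , Δ) ∷ []) ((e +ᵉ f) ∷ Γ , Δ)
  ∩-l  : ∀ {Γ Δ e f} → LogicalRule ((e ∷ f ∷ Γ , Δ) ∷ []) ((e ∩ᵉ f) ∷ Γ , Δ)
  μ-l  : ∀ {Γ Δ e} → LogicalRule ((e [ μ e ] ∷ Γ , Δ) ∷ []) (μ e ∷ Γ , Δ)
  ν-l  : ∀ {Γ Δ e} → LogicalRule ((e [ ν e ] ∷ Γ , Δ) ∷ []) (ν e ∷ Γ , Δ)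
  0-r  : ∀ {Γ Δ} → LogicalRule ((Γ , Δ) ∷ []) (Γ , 0ᵉ ∷ Δ)
  ⊤-r  : ∀ {Γ Δ} → LogicalRule [] (Γ , ⊤ᵉ ∷ Δ)
  +-r  : ∀ {Γ Δ e f} → LogicalRule ((Γ , e ∷ f ∷ Δ) ∷ []) (Γ , (e +ᵉ f) ∷ Δ)
  ∩-r  : ∀ {Γ Δ e f} → LogicalRule ((Γ , e ∷ Δ) ∷ (Γ , f ∷ Δ) ∷ []) (Γ , (e ∩ᵉ f) ∷ Δ)
  μ-r  : ∀ {Γ Δ e} → LogicalRule ((Γ , e [ μ e ] ∷ Δ) ∷ []) (Γ , μ e ∷ Δ)
  ν-r  : ∀ {Γ Δ e} → LogicalRule ((Γ , e [ ν e ] ∷ Δ) ∷ []) (Γ , ν e ∷ Δ)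

LogicalApplies : ∀ {k} → Sequent k → Set
LogicalApplies {k} S = Σ (List (Sequent k)) λ ps → Σ (Sequent k) λ C → LogicalRule ps C × (C ≈ S)

data HasHead {k} (a : Fin k) : Closed k → Set where
  head : ∀ e → HasHead a (a ∙ e)

Prefixed : ∀ {k} → Closed k → Set
Prefixed e = ∃ λ a → HasHead a e

-- Γ_a : the e such that a e is in the list (so a list of prefixed
-- formulas is ⋃_a a(strip a ·)).
match : ∀ {k} → Fin k → Closed k → Maybe (Closed k)
match a (b ∙ e) = if does (b ≟ a) then just e else nothing
match a _       = nothing

strip : ∀ {k} → Fin k → Cedent k → Cedent k
strip a = mapMaybe (match a)

-- One move of a play in which Prover follows 𝔓:
-- PMove S S' means S' may be the next current sequent after S
-- (Prover chooses the inference according to 𝔓, Denier a premiss).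
-- Weakening steps are single inferences whose premiss is visited.

data PMove {k} : Sequent k → Sequent k → Set where
  logical : ∀ {S ps C S'} → LogicalRule ps C → C ≈ S → S' ∈ ps → PMove S S'
  -- LHS contains a e and b f, a ≠ b: weaken to  a e , b f →  (then (p-l), an axiom)
  clash   : ∀ {S a b e f} → ¬ LogicalApplies S → a ≢ b →
            (a ∙ e) ∈ lhs S → (b ∙ f) ∈ lhs S →
            PMove S ((a ∙ e) ∷ (b ∙ f) ∷ [] , [])
  -- S = aΓ → ⋃_b bΔ_b with Γ ≠ ∅: weaken away the bΔ_b (b ≠ a) ...
  weak-h  : ∀ {S} a → ¬ LogicalApplies S → lhs S ≢ [] →
            All (HasHead a) (lhs S) → All Prefixed (rhs S) →
            PMove S (lhs S , map (a ∙_) (strip a (rhs S)))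
  -- ... and apply (h_a) to  aΓ → aΔ_a , giving premiss Γ → Δ_a
  hₐ      : ∀ {S} a → ¬ LogicalApplies S → lhs S ≢ [] →
            All (HasHead a) (lhs S) → All (HasHead a) (rhs S) →
            PMove S (strip a (lhs S) , strip a (rhs S))
  -- S = → ⋃_a aΔ_a: apply (p-r); Denier picks a premiss → Δ_a
  p-r     : ∀ {S} a → ¬ LogicalApplies S → lhs S ≡ [] →
            All Prefixed (rhs S) →
            PMove S ([] , strip a (rhs S))

-- Every move of 𝔓 is semantically invertible. The logical rules are, because by
-- Knaster–Tarski and the substitution lemma 𝓛(σX e(X)) = 𝓛(e(σX e(X))) for both
-- fixed points. A weakening 𝔓 performs before (h_a) only discards right formulas
-- b f with b ≠ a, which no word satisfying the nonempty left side aΓ can satisfy;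
-- and (h_a), (p-r) strip a first letter that every relevant word carries, so a
-- countermodel w of the premiss yields the countermodel a w of the conclusion.
module Submission where

open import Defs
open import Level using (0ℓ) renaming (suc to lsuc)
open import Data.Nat using (ℕ; zero; suc)
open import Data.Fin using (Fin; zero; suc; _≟_)
open import Data.Maybe using (just; nothing)
open import Data.Product as Product using (Σ; _×_; _,_; proj₁; proj₂)
open import Data.Sum as Sum using (inj₁; inj₂)
open import Data.Empty using (⊥-elim)
open import Data.Unit using (tt)
open import Data.List using (List; []; _∷_)
open import Data.List.Membership.Propositional using (_∈_; find; lose)
open import Data.List.Relation.Unary.All as All using (All; []; _∷_)
open import Data.List.Relation.Unary.Any as Any using (Any; here; there)
open import Data.List.Relation.Unary.Any.Properties using (map⁺)
open import Relation.Nullary using (yes; no)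
open import Relation.Nullary.Decidable using (toWitness; fromWitness)
open import Relation.Binary.PropositionalEquality using (_≡_; _≢_; refl; sym; trans)
open import Relation.Binary.Construct.Closure.ReflexiveTransitive using (Star; ε; _◅_)
open import Relation.Unary using (_∪_; _∩_)
open import Axiom.ExcludedMiddle using (ExcludedMiddle)

private variable
  k m n : ℕ
  a : Fin k
  A A′ B B′ C : Lang k
  F G : Lang k → Lang k

infix 4 _≐_

_≐_ : Lang k → Lang k → Set
A ≐ B = (A ⊆ B) × (B ⊆ A)

⊆-refl : A ⊆ A
⊆-refl w x = x

⊆-trans : A ⊆ B → B ⊆ C → A ⊆ C
⊆-trans A⊆B B⊆C w x = B⊆C w (A⊆B w x)

≐-refl : A ≐ A
≐-refl = ⊆-refl , ⊆-refl

≐-sym : A ≐ B → B ≐ A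
≐-sym (A⊆B , B⊆A) = B⊆A , A⊆B

≐-trans : A ≐ B → B ≐ C → A ≐ C
≐-trans (A⊆B , B⊆A) (B⊆C , C⊆B) = ⊆-trans A⊆B B⊆C , ⊆-trans C⊆B B⊆A

_◃_ : Fin k → Lang k → Lang k
(a ◃ A) w = w 0 ≡ a × A (tail w)

◃-mono : A ⊆ B → (a ◃ A) ⊆ (a ◃ B)
◃-mono A⊆B w = Product.map₂ (A⊆B (tail w))

∪-mono : A ⊆ A′ → B ⊆ B′ → (A ∪ B) ⊆ (A′ ∪ B′)
∪-mono A⊆A′ B⊆B′ w = Sum.map (A⊆A′ w) (B⊆B′ w)

∩-mono : A ⊆ A′ → B ⊆ B′ → (A ∩ B) ⊆ (A′ ∩ B′)
∩-mono A⊆A′ B⊆B′ w = Product.map (A⊆A′ w) (B⊆B′ w)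

◃-cong : A ≐ B → (a ◃ A) ≐ (a ◃ B)
◃-cong (A⊆B , B⊆A) = ◃-mono A⊆B , ◃-mono B⊆A

∪-cong : A ≐ A′ → B ≐ B′ → (A ∪ B) ≐ (A′ ∪ B′)
∪-cong (A⊆A′ , A′⊆A) (B⊆B′ , B′⊆B) = ∪-mono A⊆A′ B⊆B′ , ∪-mono A′⊆A B′⊆B

∩-cong : A ≐ A′ → B ≐ B′ → (A ∩ B) ≐ (A′ ∩ B′)
∩-cong (A⊆A′ , A′⊆A) (B⊆B′ , B′⊆B) = ∩-mono A⊆A′ B⊆B′ , ∩-mono A′⊆A B′⊆B

Monotone : (Lang k → Lang k) → Set₁
Monotone F = ∀ {A B} → A ⊆ B → F A ⊆ F B

_∷ʷ_ : Fin k → Word k → Word k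
(a ∷ʷ w) zero    = a
(a ∷ʷ w) (suc i) = w i

module _ (em : ExcludedMiddle (lsuc 0ℓ)) where

  lfp gfp : (Lang k → Lang k) → Lang k
  lfp F w = Resize em ((A : Lang _) → F A ⊆ A → A w)
  gfp F w = Resize em (Σ (Lang _) λ A → (A ⊆ F A) × A w)

  lfp-mono : (∀ A → F A ⊆ G A) → lfp F ⊆ lfp G
  lfp-mono F⊆G w x = fromWitness λ A GA⊆A → toWitness x A (⊆-trans (F⊆G A) GA⊆A)

  gfp-mono : (∀ A → F A ⊆ G A) → gfp F ⊆ gfp G
  gfp-mono F⊆G w x = let (A , A⊆FA , Aw) = toWitness x in
    fromWitness (A , ⊆-trans A⊆FA (F⊆G A) , Aw)

  lfp-cong : (∀ A → F A ≐ G A) → lfp F ≐ lfp G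
  lfp-cong F≐G = lfp-mono (λ A → proj₁ (F≐G A)) , lfp-mono (λ A → proj₂ (F≐G A))

  gfp-cong : (∀ A → F A ≐ G A) → gfp F ≐ gfp G
  gfp-cong F≐G = gfp-mono (λ A → proj₁ (F≐G A)) , gfp-mono (λ A → proj₂ (F≐G A))

  lfp-fixed : Monotone F → lfp F ≐ F (lfp F)
  lfp-fixed {F = F} F-mono = unfold , fold
    where
    fold : F (lfp F) ⊆ lfp F
    fold w x = fromWitness λ A FA⊆A → FA⊆A w (F-mono (λ v y → toWitness y A FA⊆A) w x)

    unfold : lfp F ⊆ F (lfp F)
    unfold w x = toWitness x (F (lfp F)) (F-mono fold)

  gfp-fixed : Monotone F → gfp F ≐ F (gfp F)
  gfp-fixed {F = F} F-mono = unfold , fold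
    where
    unfold : gfp F ⊆ F (gfp F)
    unfold w x = let (A , A⊆FA , Aw) = toWitness x in
      F-mono (λ v Av → fromWitness (A , A⊆FA , Av)) w (A⊆FA w Aw)

    fold : F (gfp F) ⊆ gfp F
    fold w x = fromWitness (F (gfp F) , F-mono unfold , x)

  private variable
    ρ ρ′ : Fin n → Lang k

  ∷ᵉ-mono : A ⊆ B → (∀ i → ρ i ⊆ ρ′ i) → ∀ i → (A ∷ᵉ ρ) i ⊆ (B ∷ᵉ ρ′) i
  ∷ᵉ-mono A⊆B ρ⊆ρ′ zero    = A⊆B
  ∷ᵉ-mono A⊆B ρ⊆ρ′ (suc i) = ρ⊆ρ′ i

  ⟦⟧-mono : (e : Expr k n) → (∀ i → ρ i ⊆ ρ′ i) → ⟦ e ⟧ em ρ ⊆ ⟦ e ⟧ em ρ′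
  ⟦⟧-mono (var i)  ρ⊆ρ′ = ρ⊆ρ′ i
  ⟦⟧-mono (a ∙ e)  ρ⊆ρ′ = ◃-mono (⟦⟧-mono e ρ⊆ρ′)
  ⟦⟧-mono 0ᵉ       ρ⊆ρ′ = ⊆-refl
  ⟦⟧-mono (e +ᵉ f) ρ⊆ρ′ = ∪-mono (⟦⟧-mono e ρ⊆ρ′) (⟦⟧-mono f ρ⊆ρ′)
  ⟦⟧-mono (μ e)    ρ⊆ρ′ = lfp-mono λ A → ⟦⟧-mono e (∷ᵉ-mono ⊆-refl ρ⊆ρ′)
  ⟦⟧-mono ⊤ᵉ       ρ⊆ρ′ = ⊆-refl
  ⟦⟧-mono (e ∩ᵉ f) ρ⊆ρ′ = ∩-mono (⟦⟧-mono e ρ⊆ρ′) (⟦⟧-mono f ρ⊆ρ′)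
  ⟦⟧-mono (ν e)    ρ⊆ρ′ = gfp-mono λ A → ⟦⟧-mono e (∷ᵉ-mono ⊆-refl ρ⊆ρ′)

  body-mono : (e : Expr k (suc n)) (ρ : Fin n → Lang k) → Monotone (λ A → ⟦ e ⟧ em (A ∷ᵉ ρ))
  body-mono e ρ A⊆B = ⟦⟧-mono e (∷ᵉ-mono A⊆B λ _ → ⊆-refl)

  ∷ᵉ-ext : (r : Fin m → Fin n) → (∀ i → ρ i ≐ ρ′ (r i)) →
           ∀ i → (A ∷ᵉ ρ) i ≐ (A ∷ᵉ ρ′) (ext r i)
  ∷ᵉ-ext r ρ≐ρ′ zero    = ≐-refl
  ∷ᵉ-ext r ρ≐ρ′ (suc i) = ρ≐ρ′ i

  ⟦⟧-ren : (e : Expr k m) (r : Fin m → Fin n) →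
           (∀ i → ρ i ≐ ρ′ (r i)) → ⟦ e ⟧ em ρ ≐ ⟦ ren r e ⟧ em ρ′
  ⟦⟧-ren (var i)  r ρ≐ρ′ = ρ≐ρ′ i
  ⟦⟧-ren (a ∙ e)  r ρ≐ρ′ = ◃-cong (⟦⟧-ren e r ρ≐ρ′)
  ⟦⟧-ren 0ᵉ       r ρ≐ρ′ = ≐-refl
  ⟦⟧-ren (e +ᵉ f) r ρ≐ρ′ = ∪-cong (⟦⟧-ren e r ρ≐ρ′) (⟦⟧-ren f r ρ≐ρ′)
  ⟦⟧-ren (μ e)    r ρ≐ρ′ = lfp-cong λ A → ⟦⟧-ren e (ext r) (∷ᵉ-ext r ρ≐ρ′)
  ⟦⟧-ren ⊤ᵉ       r ρ≐ρ′ = ≐-refl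
  ⟦⟧-ren (e ∩ᵉ f) r ρ≐ρ′ = ∩-cong (⟦⟧-ren e r ρ≐ρ′) (⟦⟧-ren f r ρ≐ρ′)
  ⟦⟧-ren (ν e)    r ρ≐ρ′ = gfp-cong λ A → ⟦⟧-ren e (ext r) (∷ᵉ-ext r ρ≐ρ′)

  ∷ᵉ-exts : (σ : Fin m → Expr k n) → (∀ i → ρ i ≐ ⟦ σ i ⟧ em ρ′) →
            ∀ i → (A ∷ᵉ ρ) i ≐ ⟦ exts σ i ⟧ em (A ∷ᵉ ρ′)
  ∷ᵉ-exts σ ρ≐σ zero    = ≐-refl
  ∷ᵉ-exts σ ρ≐σ (suc i) = ≐-trans (ρ≐σ i) (⟦⟧-ren (σ i) suc λ _ → ≐-refl)

  ⟦⟧-sub : (e : Expr k m) (σ : Fin m → Expr k n) →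
           (∀ i → ρ i ≐ ⟦ σ i ⟧ em ρ′) → ⟦ e ⟧ em ρ ≐ ⟦ sub σ e ⟧ em ρ′
  ⟦⟧-sub (var i)  σ ρ≐σ = ρ≐σ i
  ⟦⟧-sub (a ∙ e)  σ ρ≐σ = ◃-cong (⟦⟧-sub e σ ρ≐σ)
  ⟦⟧-sub 0ᵉ       σ ρ≐σ = ≐-refl
  ⟦⟧-sub (e +ᵉ f) σ ρ≐σ = ∪-cong (⟦⟧-sub e σ ρ≐σ) (⟦⟧-sub f σ ρ≐σ)
  ⟦⟧-sub (μ e)    σ ρ≐σ = lfp-cong λ A → ⟦⟧-sub e (exts σ) (∷ᵉ-exts σ ρ≐σ)
  ⟦⟧-sub ⊤ᵉ       σ ρ≐σ = ≐-refl
  ⟦⟧-sub (e ∩ᵉ f) σ ρ≐σ = ∩-cong (⟦⟧-sub e σ ρ≐σ) (⟦⟧-sub f σ ρ≐σ)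
  ⟦⟧-sub (ν e)    σ ρ≐σ = gfp-cong λ A → ⟦⟧-sub e (exts σ) (∷ᵉ-exts σ ρ≐σ)

  ⟦⟧-[] : (e : Expr k (suc n)) (g : Expr k n) → ⟦ e [ g ] ⟧ em ρ ≐ ⟦ e ⟧ em (⟦ g ⟧ em ρ ∷ᵉ ρ)
  ⟦⟧-[] e g = ≐-sym (⟦⟧-sub e _ λ { zero → ≐-refl ; (suc i) → ≐-refl })

  μ-unfolding : (e : Expr k (suc n)) → ⟦ μ e ⟧ em ρ ≐ ⟦ e [ μ e ] ⟧ em ρ
  μ-unfolding {ρ = ρ} e = ≐-trans (lfp-fixed (body-mono e ρ)) (≐-sym (⟦⟧-[] e (μ e)))

  ν-unfolding : (e : Expr k (suc n)) → ⟦ ν e ⟧ em ρ ≐ ⟦ e [ ν e ] ⟧ em ρ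
  ν-unfolding {ρ = ρ} e = ≐-trans (gfp-fixed (body-mono e ρ)) (≐-sym (⟦⟧-[] e (ν e)))

  private variable
    Γ Δ : Cedent k
    S S′ : Sequent k

  Valid-resp-≈ : S ≈ S′ → Valid em S′ → Valid em S
  Valid-resp-≈ ((_ , Γ′⊆Γ) , (_ , Δ′⊆Δ)) V w Γw =
    let (f , f∈Δ′ , fw) = find (V w (All.tabulate λ e∈Γ′ → All.lookup Γw (Γ′⊆Γ e∈Γ′))) in
    lose (Δ′⊆Δ f∈Δ′) fw

  replace-left : {e f : Closed k} → 𝓛 em f ⊆ 𝓛 em e → Valid em (e ∷ Γ , Δ) → Valid em (f ∷ Γ , Δ)
  replace-left f⊆e V w (fw ∷ Γw) = V w (f⊆e w fw ∷ Γw)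

  replace-right : {e f : Closed k} → 𝓛 em e ⊆ 𝓛 em f → Valid em (Γ , e ∷ Δ) → Valid em (Γ , f ∷ Δ)
  replace-right e⊆f V w Γw with V w Γw
  ... | here ew = here (e⊆f w ew)
  ... | there Δw = there Δw

  LogicalRule-invertible : {ps : List (Sequent k)} {C : Sequent k} →
                           LogicalRule ps C → S ∈ ps → Valid em C → Valid em S
  LogicalRule-invertible 0-l ()
  LogicalRule-invertible ⊤-l (here refl) V w Γw = V w (tt ∷ Γw)
  LogicalRule-invertible +-l (here refl) = replace-left λ _ → inj₁
  LogicalRule-invertible +-l (there (here refl)) = replace-left λ _ → inj₂
  LogicalRule-invertible ∩-l (here refl) V w (ew ∷ fw ∷ Γw) = V w ((ew , fw) ∷ Γw)
  LogicalRule-invertible (μ-l {e = e}) (here refl) = replace-left (proj₂ (μ-unfolding e))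
  LogicalRule-invertible (ν-l {e = e}) (here refl) = replace-left (proj₂ (ν-unfolding e))
  LogicalRule-invertible 0-r (here refl) V w Γw with V w Γw
  ... | there Δw = Δw
  LogicalRule-invertible ⊤-r ()
  LogicalRule-invertible +-r (here refl) V w Γw with V w Γw
  ... | here (inj₁ ew) = here ew
  ... | here (inj₂ fw) = there (here fw)
  ... | there Δw = there (there Δw)
  LogicalRule-invertible ∩-r (here refl) = replace-right λ _ → proj₁
  LogicalRule-invertible ∩-r (there (here refl)) = replace-right λ _ → proj₂
  LogicalRule-invertible (μ-r {e = e}) (here refl) = replace-right (proj₁ (μ-unfolding e))
  LogicalRule-invertible (ν-r {e = e}) (here refl) = replace-right (proj₁ (ν-unfolding e))

  ∈-strip : {g : Closed k} → (a ∙ g) ∈ Γ → g ∈ strip a Γ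
  ∈-strip {a = a} (here refl) with a ≟ a
  ... | yes _  = here refl
  ... | no a≢a = ⊥-elim (a≢a refl)
  ∈-strip {a = a} {Γ = e ∷ Γ} (there g∈Γ) with match a e
  ... | just _  = there (∈-strip g∈Γ)
  ... | nothing = ∈-strip g∈Γ

  Any-strip : {w : Word k} → w 0 ≡ a → All Prefixed Δ →
              Any (λ f → 𝓛 em f w) Δ → Any (λ g → 𝓛 em g (tail w)) (strip a Δ)
  Any-strip {Δ = Δ} {w = w} refl prefixed Δw =
    let (f , f∈Δ , fw) = find Δw in strip-witness (All.lookup prefixed f∈Δ) f∈Δ fw
    where
    strip-witness : ∀ {f} → Prefixed f → f ∈ Δ → 𝓛 em f w →
                    Any (λ g → 𝓛 em g (tail w)) (strip (w 0) Δ)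
    strip-witness (_ , head g) f∈Δ (refl , gw) = lose (∈-strip f∈Δ) gw

  All-unstrip : {w : Word k} → w 0 ≡ a → All (HasHead a) Γ →
                All (λ g → 𝓛 em g (tail w)) (strip a Γ) → All (λ e → 𝓛 em e w) Γ
  All-unstrip {Γ = Γ} {w = w} w₀≡a headed Γw =
    All.tabulate λ e∈Γ → unstrip (All.lookup headed e∈Γ) e∈Γ
    where
    unstrip : ∀ {e} → HasHead _ e → e ∈ Γ → 𝓛 em e w
    unstrip (head g) e∈Γ = w₀≡a , All.lookup Γw (∈-strip e∈Γ)

  head-forced : {w : Word k} → Γ ≢ [] → All (HasHead a) Γ → All (λ e → 𝓛 em e w) Γ → w 0 ≡ a
  head-forced Γ≢[] []           []               = ⊥-elim (Γ≢[] refl)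
  head-forced Γ≢[] (head g ∷ _) ((w₀≡a , _) ∷ _) = w₀≡a

  PMove-preserves-Valid : PMove S S′ → Valid em S → Valid em S′
  PMove-preserves-Valid (logical rule C≈S S′∈ps) V =
    LogicalRule-invertible rule S′∈ps (Valid-resp-≈ C≈S V)
  PMove-preserves-Valid (clash _ a≢b _ _) V w ((w₀≡a , _) ∷ (w₀≡b , _) ∷ []) =
    ⊥-elim (a≢b (trans (sym w₀≡a) w₀≡b))
  PMove-preserves-Valid (weak-h a _ Γ≢[] headed prefixed) V w Γw =
    let w₀≡a = head-forced Γ≢[] headed Γw in
    map⁺ (Any.map (w₀≡a ,_) (Any-strip w₀≡a prefixed (V w Γw)))
  PMove-preserves-Valid (hₐ a _ _ headedΓ headedΔ) V w Γw =
    Any-strip refl (All.map (a ,_) headedΔ) (V (a ∷ʷ w) (All-unstrip refl headedΓ Γw))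
  PMove-preserves-Valid (p-r a _ refl prefixed) V w [] = Any-strip refl prefixed (V (a ∷ʷ w) [])

proposition41 : (em : ExcludedMiddle (lsuc 0ℓ)) {k : ℕ} {S S' : Sequent k} →
                Star PMove S S' → Valid em S → Valid em S'
proposition41 em ε        V = V
proposition41 em (m ◅ ms) V = proposition41 em ms (PMove-preserves-Valid em m V)
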